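{- Let $d\ge1$, $r\ge2$, and $N\ge r-1$ be integers, and assume that the continuous map $f : \Delta_{N} \to \mathbb{R}^d$ has a Tverberg $r$-partition. Then: (i) For any set of $N-r+2$ vertices of $\Delta_N$, the face (simplex) $\Delta_{N-(r-1)}$ of $\Delta_N$ spanned by them is Tverberg unavoidable for $f$. (ii) For any set $S$ of at most $2r-1$ vertices of $\Delta_N$, the subcomplex of $\Delta_N$ consisting of all faces with at most one vertex in $S$ is Tverberg unavoidable for $f$. (iii) If $k$ is an integer with $r(k+2)> N+1$, then the $k$-skeleton $\Delta_N^{(k)}$ of $\Delta_N$ is Tverberg unavoidable for $f$. (iv) If $k\ge0$ and $s$ are integers with $0\le s\le r$ and $r(k+1)+s> N+1$, and $\Delta_{N-(r-s)}$ denotes the face of $\Delta_N$ spanned by all vertices except some fixed $r-s$ of them, then the subcomplex $\Delta_N^{(k-1)}\cup\Delta_{N-(r-s)}^{(k)}$ of $\Delta_N$ is Tverberg unavoidable for $f$.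
   Context: $\Delta_N$ denotes the $N$-dimensional simplex with $N+1$ vertices; $K^{(k)}$ denotes the $k$-skeleton of a complex $K$. For a continuous map $f:\Delta_N\to\mathbb{R}^d$, a Tverberg $r$-partition for $f$ is a set $\{\sigma_1,\dots,\sigma_r\}$ of pairwise (vertex-)disjoint faces of $\Delta_N$ with $f(\sigma_1)\cap\dots\cap f(\sigma_r)\ne\emptyset$. If $f$ has at least one Tverberg $r$-partition, a subcomplex $\Sigma\subseteq\Delta_N$ is called Tverberg unavoidable (for $f$, with parameter $r$) if for every Tverberg $r$-partition $\{\sigma_1,\dots,\sigma_r\}$ for $f$ at least one face $\sigma_j$ lies in $\Sigma$. -}

module Defs where

open import Level using (0ℓ)
open import Data.Nat as ℕ using (ℕ; zero; suc)
open import Data.Fin using (Fin; zero; suc)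
open import Data.Fin.Subset using (Subset; _∈_; _⊆_; _∩_; ∣_∣; Empty)
open import Data.Product using (Σ; ∃; _×_; _,_)
open import Data.Sum using (_⊎_)
open import Relation.Binary.PropositionalEquality using (_≡_)
open import Relation.Binary.Structures using (IsStrictTotalOrder)
open import Algebra.Structures using (IsCommutativeRing)
open import Relation.Nullary using (¬_)

-- The real numbers, axiomatised as a Dedekind-complete ordered field
-- (unique up to isomorphism).  The theorem is stated for every such
-- structure, i.e. for ℝ.

record RealField : Set₁ where
  infixl 6 _+_
  infixl 7 _*_
  infix  4 _<_ _≤_
  field
    Carrier : Set
    _+_ _*_ : Carrier → Carrier → Carrier
    -_      : Carrier → Carrier
    0# 1#   : Carrier
    _<_     : Carrier → Carrier → Set
    isCommutativeRing : IsCommutativeRing _≡_ _+_ _*_ -_ 0# 1#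
    isStrictTotalOrder : IsStrictTotalOrder _≡_ _<_
    0≢1     : ¬ (0# ≡ 1#)
    inverse : ∀ x → ¬ (x ≡ 0#) → ∃ λ y → x * y ≡ 1#
    +-mono-< : ∀ {a b} c → a < b → a + c < b + c
    *-pos   : ∀ {a b} → 0# < a → 0# < b → 0# < a * b

  _≤_ : Carrier → Carrier → Set
  a ≤ b = a < b ⊎ a ≡ b

  field
    sup : (P : Carrier → Set) → ∃ P → (∃ λ b → ∀ x → P x → x ≤ b) →
          ∃ λ s → (∀ x → P x → x ≤ s) × (∀ b → (∀ x → P x → x ≤ b) → s ≤ b)

  _-_ : Carrier → Carrier → Carrier
  a - b = a + (- b)

  close : Carrier → Carrier → Carrier → Set
  close ε a b = (- ε < a - b) × (a - b < ε)

module Geometry (R : RealField) where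
  open RealField R

  ℝ^ : ℕ → Set
  ℝ^ d = Fin d → Carrier

  sumFin : ∀ {n} → (Fin n → Carrier) → Carrier
  sumFin {zero}  x = 0#
  sumFin {suc n} x = x zero + sumFin (λ i → x (suc i))

  -- points of the geometric simplex Δ_N (vertices Fin (suc N)),
  -- in barycentric coordinates
  record Point (N : ℕ) : Set where
    constructor point
    field
      coord    : Fin (suc N) → Carrier
      nonneg   : ∀ i → 0# ≤ coord i
      sumOne   : sumFin coord ≡ 1#
  open Point public

  -- continuity of f : Δ_N → ℝ^d (Δ_N ⊆ ℝ^{N+1} with the max-metric,
  -- ℝ^d with the max-metric)
  Continuous : ∀ {N d} → (Point N → ℝ^ d) → Set
  Continuous {N} {d} f =
    ∀ (p : Point N) (ε : Carrier) → 0# < ε →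
      ∃ λ δ → 0# < δ × (∀ (q : Point N) → (∀ i → close δ (coord p i) (coord q i)) →
                          ∀ j → close ε (f p j) (f q j))

  -- faces of Δ_N are vertex subsets; a point lies in the closed face σ
  -- iff its support is contained in σ
  _∈∣_∣ : ∀ {N} → Point N → Subset (suc N) → Set
  p ∈∣ σ ∣ = ∀ i → ¬ (coord p i ≡ 0#) → i ∈ σ

  InImage : ∀ {N d} → (Point N → ℝ^ d) → Subset (suc N) → ℝ^ d → Set
  InImage f σ y = ∃ λ p → p ∈∣ σ ∣ × (∀ j → f p j ≡ y j)

  TverbergPartition : ∀ {N d} → (Point N → ℝ^ d) → (r : ℕ) → (Fin r → Subset (suc N)) → Set
  TverbergPartition {N} f r σ =
    (∀ a b → ¬ (a ≡ b) → Empty (σ a ∩ σ b)) ×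
    ∃ λ y → ∀ a → InImage f (σ a) y

  -- a subcomplex is given by the predicate "τ is a face of it"
  Complex : ℕ → Set₁
  Complex N = Subset (suc N) → Set

  TverbergUnavoidable : ∀ {N d} → (Point N → ℝ^ d) → (r : ℕ) → Complex N → Set
  TverbergUnavoidable {N} f r Σc =
    ∀ σ → TverbergPartition f r σ → ∃ λ j → Σc (σ j)

-- Combinatorial subcomplexes of Δ_N (dimension of τ is ∣ τ ∣ - 1)

SpannedFace : ∀ {N} → Subset (suc N) → Subset (suc N) → Set
SpannedFace A τ = τ ⊆ A

AtMostOneIn : ∀ {N} → Subset (suc N) → Subset (suc N) → Set
AtMostOneIn S τ = ∣ τ ∩ S ∣ ℕ.≤ 1

Skeleton : ∀ {N} → ℕ → Subset (suc N) → Set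
Skeleton k τ = ∣ τ ∣ ℕ.≤ suc k

-- Δ_N^(k-1) ∪ Δ_{N-(r-s)}^(k), where Δ_{N-(r-s)} is spanned by all
-- vertices outside B
SkeletonUnionFace : ∀ {N} → ℕ → Subset (suc N) → Subset (suc N) → Set
SkeletonUnionFace k B τ = ∣ τ ∣ ℕ.≤ k ⊎ (∣ τ ∣ ℕ.≤ suc k × Empty (τ ∩ B))

-- The four statements are purely combinatorial: they hold for every map
-- f, because no r pairwise disjoint faces can all avoid the given
-- subcomplex.
--
--   * Packing: if σ₁,…,σᵣ are pairwise disjoint vertex sets and X is any
--     vertex set, then Σⱼ |σⱼ ∩ X| ≤ |X|  (induction on r, removing σ₁
--     from X).
--   * Counting criterion: let Σ be a decidable subcomplex, w a weight on
--     faces with Σⱼ w(σⱼ) ≤ W for every disjoint family, and suppose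
--     every face outside Σ has weight ≥ c.  If W < r·c then Σ is
--     Tverberg unavoidable: r faces outside Σ would weigh ≥ r·c.
--
-- Each part of the lemma instantiates the criterion with a weight built
-- from |τ ∩ X|: (i) w τ = |τ ∖ A|, c = 1; (ii) w τ = |τ ∩ S|, c = 2;
-- (iii) w τ = |τ|, c = k+2; (iv) w τ = |τ| + |τ ∩ B|, c = k+2.  What is
-- left is the arithmetic inequality W < r·c in each case.

module Submission where

open import Defs
open import Data.Nat using (ℕ; suc; _+_; _*_; _∸_; _≤_; _<_)
open import Data.Fin.Subset using (Subset; ∣_∣)
open import Data.Product using (∃; _×_)
open import Relation.Binary.PropositionalEquality using (_≡_)

open import Data.Nat using (zero; z≤n; s≤s; _≤?_)
open import Data.Nat.Properties
  using (≤-trans; ≤-reflexive; module ≤-Reasoning; ≰⇒>; <⇒≱; m≤m+n; m≤n⇒m≤1+n;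
         +-comm; +-assoc; +-suc; *-comm; *-identityʳ; *-distribˡ-+;
         +-mono-≤; +-monoʳ-≤; +-monoˡ-<; m+[n∸m]≡n; m∸[m∸n]≡n; +-0-commutativeMonoid)
open import Data.Fin using (Fin; zero; suc)
open import Data.Fin.Properties using (any?) renaming (suc-injective to Fin-suc-injective)
open import Data.Fin.Subset using (_∈_; _⊆_; _∩_; _─_; ∁; ⊤; Empty; Nonempty; inside; outside)
open import Data.Fin.Subset.Properties
  using (_⊆?_; nonempty?; ∣∁p∣≡n∸∣p∣; ∣⊤∣≡n; ∩-identityʳ; p⊆q⇒∣p∣≤∣q∣;
         x∈p∩q⁺; x∈p∩q⁻; x∈p∧x∉q⇒x∈p─q; x∉∁p⇒x∈p; x∈p⇒∣p-x∣<∣p∣)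
open import Data.Vec using ([]; _∷_)
open import Data.Product using (_,_)
open import Data.Sum using (inj₁; inj₂)
open import Data.Empty using (⊥-elim)
open import Function using (_∘_)
open import Relation.Nullary using (¬_; yes; no; ¬?)
open import Relation.Nullary.Decidable using (_⊎-dec_; _×-dec_)
open import Relation.Unary using (Decidable)
open import Relation.Binary.PropositionalEquality using (refl; sym; trans; cong; subst; module ≡-Reasoning)
open import Algebra.Properties.CommutativeMonoid.Sum +-0-commutativeMonoid using (sum; sum-cong-≗; ∑-distrib-+)

Disjoint : ∀ {n r} → (Fin r → Subset n) → Set
Disjoint σ = ∀ a b → ¬ (a ≡ b) → Empty (σ a ∩ σ b)

disjoint-tail : ∀ {n r} {σ : Fin (suc r) → Subset n} → Disjoint σ → Disjoint (σ ∘ suc)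
disjoint-tail disj a b a≢b = disj (suc a) (suc b) (a≢b ∘ Fin-suc-injective)

sum-mono : ∀ {r} {f g : Fin r → ℕ} → (∀ j → f j ≤ g j) → sum f ≤ sum g
sum-mono {zero}  f≤g = z≤n
sum-mono {suc r} f≤g = +-mono-≤ (f≤g zero) (sum-mono (f≤g ∘ suc))

sum-lower-bound : ∀ {r} (c : ℕ) (g : Fin r → ℕ) → (∀ j → c ≤ g j) → r * c ≤ sum g
sum-lower-bound {zero}  c g c≤g = z≤n
sum-lower-bound {suc r} c g c≤g = +-mono-≤ (c≤g zero) (sum-lower-bound c (g ∘ suc) (c≤g ∘ suc))

nonempty⇒1≤∣p∣ : ∀ {n} {p : Subset n} → Nonempty p → 1 ≤ ∣ p ∣
nonempty⇒1≤∣p∣ (x , x∈p) = ≤-trans (s≤s z≤n) (x∈p⇒∣p-x∣<∣p∣ x∈p)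

∣p∩q∣+∣q─p∣≡∣q∣ : ∀ {n} (p q : Subset n) → ∣ p ∩ q ∣ + ∣ q ─ p ∣ ≡ ∣ q ∣
∣p∩q∣+∣q─p∣≡∣q∣ []            []            = refl
∣p∩q∣+∣q─p∣≡∣q∣ (inside  ∷ p) (inside  ∷ q) = cong suc (∣p∩q∣+∣q─p∣≡∣q∣ p q)
∣p∩q∣+∣q─p∣≡∣q∣ (outside ∷ p) (inside  ∷ q) =
  trans (+-suc ∣ p ∩ q ∣ ∣ q ─ p ∣) (cong suc (∣p∩q∣+∣q─p∣≡∣q∣ p q))
∣p∩q∣+∣q─p∣≡∣q∣ (inside  ∷ p) (outside ∷ q) = ∣p∩q∣+∣q─p∣≡∣q∣ p q
∣p∩q∣+∣q─p∣≡∣q∣ (outside ∷ p) (outside ∷ q) = ∣p∩q∣+∣q─p∣≡∣q∣ p q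

-- Packing: disjoint faces meet any vertex set X in at most |X| vertices
-- altogether.  The faces after the first one only meet X ∖ σ₁.
packing : ∀ {n r} (σ : Fin r → Subset n) → Disjoint σ →
          (X : Subset n) → sum (λ j → ∣ σ j ∩ X ∣) ≤ ∣ X ∣
packing {r = zero}  σ disj X = z≤n
packing {r = suc r} σ disj X = begin
  ∣ σ zero ∩ X ∣ + sum (λ j → ∣ σ (suc j) ∩ X ∣)
    ≤⟨ +-monoʳ-≤ ∣ σ zero ∩ X ∣ (sum-mono (p⊆q⇒∣p∣≤∣q∣ ∘ avoids-first)) ⟩
  ∣ σ zero ∩ X ∣ + sum (λ j → ∣ σ (suc j) ∩ (X ─ σ zero) ∣)
    ≤⟨ +-monoʳ-≤ ∣ σ zero ∩ X ∣ (packing (σ ∘ suc) (disjoint-tail disj) (X ─ σ zero)) ⟩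
  ∣ σ zero ∩ X ∣ + ∣ X ─ σ zero ∣
    ≡⟨ ∣p∩q∣+∣q─p∣≡∣q∣ (σ zero) X ⟩
  ∣ X ∣ ∎
  where
  open ≤-Reasoning
  avoids-first : ∀ j → σ (suc j) ∩ X ⊆ σ (suc j) ∩ (X ─ σ zero)
  avoids-first j {x} x∈ with x∈p∩q⁻ (σ (suc j)) X x∈
  ... | x∈σ , x∈X = x∈p∩q⁺ (x∈σ , x∈p∧x∉q⇒x∈p─q x∈X x∉σ₀)
    where
    x∉σ₀ : ¬ (x ∈ σ zero)
    x∉σ₀ x∈σ₀ = disj zero (suc j) (λ ()) (_ , x∈p∩q⁺ (x∈σ₀ , x∈σ))

packing-card : ∀ {n r} (σ : Fin r → Subset n) → Disjoint σ → sum (λ j → ∣ σ j ∣) ≤ n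
packing-card {n} σ disj = begin
  sum (λ j → ∣ σ j ∣)     ≡⟨ sum-cong-≗ (λ j → cong ∣_∣ (sym (∩-identityʳ (σ j)))) ⟩
  sum (λ j → ∣ σ j ∩ ⊤ ∣) ≤⟨ packing σ disj ⊤ ⟩
  ∣ ⊤ {n} ∣               ≡⟨ ∣⊤∣≡n n ⟩
  n                       ∎
  where open ≤-Reasoning

⊈⇒1≤∣τ∩∁A∣ : ∀ {n} (τ A : Subset n) → ¬ (τ ⊆ A) → 1 ≤ ∣ τ ∩ ∁ A ∣
⊈⇒1≤∣τ∩∁A∣ τ A τ⊈A with nonempty? (τ ∩ ∁ A)
... | yes meets = nonempty⇒1≤∣p∣ meets
... | no misses = ⊥-elim (τ⊈A (λ x∈τ → x∉∁p⇒x∈p (λ x∈∁A → misses (_ , x∈p∩q⁺ (x∈τ , x∈∁A)))))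

complement-size : ∀ {N r} (A : Subset (suc N)) → r ≤ N → ∣ A ∣ ≡ N + 2 ∸ suc r → ∣ ∁ A ∣ ≡ r
complement-size {N} {r} A r≤N ∣A∣≡ = begin
  ∣ ∁ A ∣                  ≡⟨ ∣∁p∣≡n∸∣p∣ A ⟩
  suc N ∸ ∣ A ∣            ≡⟨ cong (suc N ∸_) ∣A∣≡ ⟩
  suc N ∸ (N + 2 ∸ suc r)  ≡⟨ cong (λ m → suc N ∸ (m ∸ suc r)) (+-comm N 2) ⟩
  suc N ∸ (suc N ∸ r)      ≡⟨ m∸[m∸n]≡n (m≤n⇒m≤1+n r≤N) ⟩
  r                        ∎
  where open ≡-Reasoning

2r∸1<r*2 : ∀ {r} → 1 ≤ r → 2 * r ∸ 1 < r * 2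
2r∸1<r*2 {suc r} _ = ≤-reflexive (*-comm 2 (suc r))

skeleton-union-bound : ∀ N r k s → s ≤ r → suc N < r * (k + 1) + s → suc N + (r ∸ s) < r * (k + 2)
skeleton-union-bound N r k s s≤r N<r[k+1]+s = begin-strict
  suc N + (r ∸ s)              <⟨ +-monoˡ-< (r ∸ s) N<r[k+1]+s ⟩
  r * (k + 1) + s + (r ∸ s)    ≡⟨ +-assoc (r * (k + 1)) s (r ∸ s) ⟩
  r * (k + 1) + (s + (r ∸ s))  ≡⟨ cong (r * (k + 1) +_) (trans (m+[n∸m]≡n s≤r) (sym (*-identityʳ r))) ⟩
  r * (k + 1) + r * 1          ≡⟨ *-distribˡ-+ r (k + 1) 1 ⟨
  r * (k + 1 + 1)              ≡⟨ cong (r *_) (+-assoc k 1 1) ⟩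
  r * (k + 2)                  ∎
  where open ≤-Reasoning

≰1+k⇒k+2≤ : ∀ {m} k → ¬ (m ≤ suc k) → k + 2 ≤ m
≰1+k⇒k+2≤ {m} k m≰1+k = subst (_≤ m) (+-comm 2 k) (≰⇒> m≰1+k)

-- A face outside Δ^(k-1) ∪ Δ_{N-(r-s)}^(k) has at least k+2 vertices, or
-- exactly k+1 vertices with one of them in B.
outside-skeleton-union : ∀ {N} k (B τ : Subset (suc N)) →
  ¬ SkeletonUnionFace k B τ → k + 2 ≤ ∣ τ ∣ + ∣ τ ∩ B ∣
outside-skeleton-union k B τ τ∉Σ with ∣ τ ∣ ≤? k | nonempty? (τ ∩ B) | ∣ τ ∣ ≤? suc k
... | yes small | _         | _        = ⊥-elim (τ∉Σ (inj₁ small))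
... | no ¬small | yes meets | _        =
  subst (_≤ ∣ τ ∣ + ∣ τ ∩ B ∣) (sym (+-suc k 1)) (+-mono-≤ (≰⇒> ¬small) (nonempty⇒1≤∣p∣ meets))
... | no _      | no misses | yes fits = ⊥-elim (τ∉Σ (inj₂ (fits , misses)))
... | no _      | no _      | no big   = ≤-trans (≰1+k⇒k+2≤ k big) (m≤m+n ∣ τ ∣ ∣ τ ∩ B ∣)

module _ (R : RealField) where
  open Geometry R

  unavoidable-by-counting :
    ∀ {N d r} (f : Point N → ℝ^ d) {Σc : Complex N} → Decidable Σc →
    (w : Subset (suc N) → ℕ) {W c : ℕ} →
    (∀ σ → Disjoint σ → sum (w ∘ σ) ≤ W) → W < r * c →
    (∀ τ → ¬ Σc τ → c ≤ w τ) → TverbergUnavoidable f r Σc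
  unavoidable-by-counting {r = r} f Σc? w {c = c} bound W<rc heavy σ (disj , _) with any? (Σc? ∘ σ)
  ... | yes found = found
  ... | no none = ⊥-elim (<⇒≱ W<rc (≤-trans all-heavy (bound σ disj)))
    where
    all-heavy : r * c ≤ sum (w ∘ σ)
    all-heavy = sum-lower-bound c (w ∘ σ) (λ j → heavy (σ j) (none ∘ (j ,_)))

  -- (i) The face spanned by N-r+2 vertices: a face outside it has a
  -- vertex among the r-1 remaining ones.
  face-unavoidable : ∀ {N d r} (f : Point N → ℝ^ d) → r ∸ 1 ≤ N → 1 ≤ r →
    (A : Subset (suc N)) → ∣ A ∣ ≡ N + 2 ∸ r → TverbergUnavoidable f r (SpannedFace A)
  face-unavoidable {r = suc r} f r≤N (s≤s _) A ∣A∣≡ =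
    unavoidable-by-counting f (_⊆? A) (λ τ → ∣ τ ∩ ∁ A ∣)
      (λ σ disj → packing σ disj (∁ A))
      (s≤s (≤-reflexive (trans (complement-size A r≤N ∣A∣≡) (sym (*-identityʳ r)))))
      (λ τ → ⊈⇒1≤∣τ∩∁A∣ τ A)

  -- (ii) Faces with at most one vertex in S: a face outside has two
  -- vertices in S, but |S| < 2r.
  at-most-one-unavoidable : ∀ {N d r} (f : Point N → ℝ^ d) → 1 ≤ r →
    (S : Subset (suc N)) → ∣ S ∣ ≤ 2 * r ∸ 1 → TverbergUnavoidable f r (AtMostOneIn S)
  at-most-one-unavoidable f 1≤r S ∣S∣≤ =
    unavoidable-by-counting f (λ τ → ∣ τ ∩ S ∣ ≤? 1) (λ τ → ∣ τ ∩ S ∣)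
      (λ σ disj → ≤-trans (packing σ disj S) ∣S∣≤) (2r∸1<r*2 1≤r) (λ τ → ≰⇒>)

  -- (iii) The k-skeleton: a face outside has k+2 vertices, but Δ_N has
  -- fewer than r(k+2) vertices.
  skeleton-unavoidable : ∀ {N d r} (f : Point N → ℝ^ d) →
    (k : ℕ) → suc N < r * (k + 2) → TverbergUnavoidable f r (Skeleton k)
  skeleton-unavoidable f k N<r[k+2] =
    unavoidable-by-counting f (λ τ → ∣ τ ∣ ≤? suc k) ∣_∣ packing-card N<r[k+2]
      (λ τ → ≰1+k⇒k+2≤ k)

  -- (iv) Δ_N^(k-1) ∪ Δ_{N-(r-s)}^(k): weigh a face by its number of
  -- vertices plus its number of vertices in B.
  skeleton-union-face-unavoidable : ∀ {N d r} (f : Point N → ℝ^ d) →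
    (k s : ℕ) → s ≤ r → suc N < r * (k + 1) + s →
    (B : Subset (suc N)) → ∣ B ∣ ≡ r ∸ s → TverbergUnavoidable f r (SkeletonUnionFace k B)
  skeleton-union-face-unavoidable {N} {r = r} f k s s≤r N<r[k+1]+s B ∣B∣≡ =
    unavoidable-by-counting f in-complex? (λ τ → ∣ τ ∣ + ∣ τ ∩ B ∣) bound
      (subst (λ b → suc N + b < r * (k + 2)) (sym ∣B∣≡) (skeleton-union-bound N r k s s≤r N<r[k+1]+s))
      (outside-skeleton-union k B)
    where
    in-complex? : Decidable (SkeletonUnionFace k B)
    in-complex? τ = (∣ τ ∣ ≤? k) ⊎-dec ((∣ τ ∣ ≤? suc k) ×-dec ¬? (nonempty? (τ ∩ B)))

    bound : ∀ σ → Disjoint σ → sum (λ j → ∣ σ j ∣ + ∣ σ j ∩ B ∣) ≤ suc N + ∣ B ∣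
    bound σ disj = begin
      sum (λ j → ∣ σ j ∣ + ∣ σ j ∩ B ∣)             ≡⟨ ∑-distrib-+ (∣_∣ ∘ σ) (λ j → ∣ σ j ∩ B ∣) ⟩
      sum (λ j → ∣ σ j ∣) + sum (λ j → ∣ σ j ∩ B ∣) ≤⟨ +-mono-≤ (packing-card σ disj) (packing σ disj B) ⟩
      suc N + ∣ B ∣                                 ∎
      where open ≤-Reasoning

-- Lemma 4.2.
lemma4p2 : (R : RealField) → let open Geometry R in
    (d r N : ℕ) → 1 ≤ d → 2 ≤ r → r ∸ 1 ≤ N →
    (f : Point N → ℝ^ d) → Continuous f →
    (∃ λ σ → TverbergPartition f r σ) →
    ((A : Subset (suc N)) → ∣ A ∣ ≡ N + 2 ∸ r →
        TverbergUnavoidable f r (SpannedFace A))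
    × ((S : Subset (suc N)) → ∣ S ∣ ≤ 2 * r ∸ 1 →
        TverbergUnavoidable f r (AtMostOneIn S))
    × ((k : ℕ) → suc N < r * (k + 2) →
        TverbergUnavoidable f r (Skeleton k))
    × ((k s : ℕ) → s ≤ r → suc N < r * (k + 1) + s →
        (B : Subset (suc N)) → ∣ B ∣ ≡ r ∸ s →
        TverbergUnavoidable f r (SkeletonUnionFace k B))
lemma4p2 R d r N _ 2≤r r∸1≤N f _ _ =
    face-unavoidable R f r∸1≤N 1≤r
  , at-most-one-unavoidable R f 1≤r
  , skeleton-unavoidable R f
  , skeleton-union-face-unavoidable R f
  where
  1≤r : 1 ≤ r
  1≤r = ≤-trans (s≤s z≤n) 2≤r
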